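{- Let $\lambda$ be a nonzero real number. For all integers $n,j$ with $n\ge j\ge0$, $$ {n \brace j}_{\lambda}=\sum_{\alpha=0}^{n}\binom{n}{\alpha}(-1)^{\alpha+j}{\alpha \brace j}_{ -\lambda}(j)_{n-\alpha,\lambda}. $$
   Context: For a real parameter $\mu$ the degenerate falling factorials are $(x)_{0,\mu}=1$ and $(x)_{n,\mu}=x(x-\mu)\cdots(x-(n-1)\mu)$ for $n\ge1$; $(x)_n=(x)_{n,1}$ is the usual falling factorial. The degenerate Stirling numbers of the second kind ${n \brace k}_{\mu}$ are defined by $(x)_{n,\mu}=\sum_{k=0}^{n}{n \brace k}_{\mu}(x)_k$, with ${n \brace k}_{\mu}=0$ for $k>n$. -}

module Defs where

open import Level using (Level)
open import Data.Nat as ℕ using (ℕ; zero; suc; _∸_)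
open import Data.Nat.Combinatorics using (_C_)
open import Data.Product using (_×_)
open import Relation.Nullary using (¬_)
open import Algebra.Bundles using (CommutativeRing)

module _ {c ℓ : Level} (R : CommutativeRing c ℓ) where
  open CommutativeRing R

  fromℕ : ℕ → Carrier
  fromℕ zero    = 0#
  fromℕ (suc n) = 1# + fromℕ n

  sign : ℕ → Carrier
  sign zero    = 1#
  sign (suc n) = - sign n

  sumTo : ℕ → (ℕ → Carrier) → Carrier
  sumTo zero    f = f 0
  sumTo (suc n) f = sumTo n f + f (suc n)

  degFall : Carrier → ℕ → Carrier → Carrier
  degFall x zero    μ = 1#
  degFall x (suc n) μ = degFall x n μ * (x - fromℕ n * μ)

  fall : Carrier → ℕ → Carrier
  fall x n = degFall x n 1#

  IsDegStirling2 : Carrier → (ℕ → ℕ → Carrier) → Set (c Level.⊔ ℓ)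
  IsDegStirling2 μ S =
    ((n : ℕ) (x : Carrier) → degFall x n μ ≈ sumTo n (λ k → S n k * fall x k))
    × ((n k : ℕ) → n ℕ.< k → S n k ≈ 0#)

  NoZeroDivisors : Set (c Level.⊔ ℓ)
  NoZeroDivisors = (a b : Carrier) → a * b ≈ 0# → (a ≈ 0#) Data.Sum.⊎ (b ≈ 0#)
    where import Data.Sum

  CharZero : Set ℓ
  CharZero = (n : ℕ) → ¬ (fromℕ (suc n) ≈ 0#)

module Submission where

-- For any family S with (x)_{n,μ} = Σ_k S n k (x)_k, the j-th forward difference at 0,
-- Δʲf(0) = Σ_i C(j,i) (-1)^{j-i} f(i), of x ↦ (x)_{α,μ} is j! S α j, since Δʲ(x)_k(0) is j!
-- for k = j and 0 otherwise. So j! S⁺ n j = Δʲ(x)_{n,λ}(0) = Σ_i C(j,i) (-1)^i (j - i)_{n,λ}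
-- after reversing the sum. The binomial theorem for degenerate falling factorials and
-- (-i)_{α,λ} = (-1)^α (i)_{α,-λ} expand (j - i)_{n,λ} as Σ_α C(n,α) (-1)^α (i)_{α,-λ} (j)_{n-α,λ};
-- exchanging the sums, the inner sum over i is (-1)^j Δʲ(x)_{α,-λ}(0) = (-1)^j j! S⁻ α j.
-- Finally j! = (j)_j is cancelled, which needs no zero divisors and characteristic zero.

open import Level using (Level)
open import Data.Nat as ℕ using (ℕ; zero; suc; _≤_; _∸_)
import Data.Nat.Properties as ℕ
open import Data.Nat.Combinatorics
  using (_C_; nCk+nC[k+1]≡[n+1]C[k+1]; k>n⇒nCk≡0; nCk≡nC[n∸k])
open import Data.Integer as ℤ using (ℤ; +_; -[1+_]; _⊖_)
import Data.Integer.Properties as ℤ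
open import Data.Maybe using (Maybe; just; nothing)
open import Data.Product using (_,_)
open import Data.Sum using (inj₁; inj₂)
open import Relation.Nullary using (¬_; yes; no; contradiction)
open import Relation.Binary.Definitions using (tri<; tri≈; tri>)
import Relation.Binary.PropositionalEquality as ≡
open import Algebra.Bundles using (CommutativeRing)
open import Algebra.Solver.Ring.AlmostCommutativeRing
  using (fromCommutativeRing; _-Raw-AlmostCommutative⟶_)

open import Defs

module FromℕProperties {c ℓ : Level} (R : CommutativeRing c ℓ) where
  open CommutativeRing R
  open import Algebra.Properties.Semiring.Mult semiring using (_×_; ×-homo-+; ×1-homo-*)
  open import Relation.Binary.Reasoning.Setoid setoid

  fromℕ≈×1# : ∀ n → fromℕ R n ≈ n × 1#
  fromℕ≈×1# zero    = refl
  fromℕ≈×1# (suc n) = +-congˡ (fromℕ≈×1# n)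

  fromℕ-+ : ∀ m n → fromℕ R (m ℕ.+ n) ≈ fromℕ R m + fromℕ R n
  fromℕ-+ m n = begin
    fromℕ R (m ℕ.+ n)      ≈⟨ fromℕ≈×1# (m ℕ.+ n) ⟩
    (m ℕ.+ n) × 1#         ≈⟨ ×-homo-+ 1# m n ⟩
    m × 1# + n × 1#        ≈⟨ +-cong (fromℕ≈×1# m) (fromℕ≈×1# n) ⟨
    fromℕ R m + fromℕ R n  ∎

  fromℕ-* : ∀ m n → fromℕ R (m ℕ.* n) ≈ fromℕ R m * fromℕ R n
  fromℕ-* m n = begin
    fromℕ R (m ℕ.* n)      ≈⟨ fromℕ≈×1# (m ℕ.* n) ⟩
    (m ℕ.* n) × 1#         ≈⟨ ×1-homo-* m n ⟩
    m × 1# * n × 1#        ≈⟨ *-cong (fromℕ≈×1# m) (fromℕ≈×1# n) ⟨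
    fromℕ R m * fromℕ R n  ∎

  fromℕ-∸ : ∀ {m n} → m ≤ n → fromℕ R (n ∸ m) ≈ fromℕ R n - fromℕ R m
  fromℕ-∸ {m} {n} m≤n = begin
    fromℕ R (n ∸ m)                            ≈⟨ +-identityʳ _ ⟨
    fromℕ R (n ∸ m) + 0#                       ≈⟨ +-congˡ (-‿inverseʳ _) ⟨
    fromℕ R (n ∸ m) + (fromℕ R m - fromℕ R m)  ≈⟨ +-assoc _ _ _ ⟨
    fromℕ R (n ∸ m) + fromℕ R m - fromℕ R m    ≈⟨ +-congʳ (fromℕ-+ (n ∸ m) m) ⟨
    fromℕ R (n ∸ m ℕ.+ m) - fromℕ R m          ≡⟨ ≡.cong (λ k → fromℕ R k - fromℕ R m) n∸m+m≡n ⟩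
    fromℕ R n - fromℕ R m                      ∎
    where n∸m+m≡n = ℕ.m∸n+n≡m m≤n

-- The ring solver needs coefficients with a decidable equality mapped into R; ℤ maps into every ring.
module ℤ-Solver {c ℓ : Level} (R : CommutativeRing c ℓ) where
  open CommutativeRing R
  open FromℕProperties R
  open import Algebra.Properties.Monoid.Mult.TCOptimised +-monoid
    using (×ᵤ≈×) renaming (_×_ to _×′_)
  open import Algebra.Properties.Ring ring using (-‿distribˡ-*; -‿distribʳ-*)
  open import Algebra.Properties.AbelianGroup +-abelianGroup
    using (⁻¹-∙-comm; ⁻¹-involutive; ε⁻¹≈ε; ⁻¹-anti-homo-//)
  open import Relation.Binary.Reasoning.Setoid setoid

  -- n ×′ 1# rather than fromℕ R n, so that the coefficients 0 and 1 denote 0# and 1# definitionally.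
  fromℤ : ℤ → Carrier
  fromℤ (+ n)    = n ×′ 1#
  fromℤ -[1+ n ] = - (suc n ×′ 1#)

  fromℤ-pos : ∀ n → fromℤ (+ n) ≈ fromℕ R n
  fromℤ-pos n = sym (trans (fromℕ≈×1# n) (×ᵤ≈× n 1#))

  fromℤ-neg : ∀ i → fromℤ (ℤ.- i) ≈ - fromℤ i
  fromℤ-neg (+ zero)  = sym ε⁻¹≈ε
  fromℤ-neg (+ suc n) = refl
  fromℤ-neg -[1+ n ]  = sym (⁻¹-involutive _)

  fromℤ-⊖ : ∀ m n → fromℤ (m ⊖ n) ≈ fromℕ R m - fromℕ R n
  fromℤ-⊖ m n with m ℕ.<? n
  ... | yes m<n = begin
    fromℤ (m ⊖ n)              ≡⟨ ≡.cong fromℤ (ℤ.⊖-< m<n) ⟩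
    fromℤ (ℤ.- + (n ∸ m))      ≈⟨ fromℤ-neg (+ (n ∸ m)) ⟩
    - fromℤ (+ (n ∸ m))        ≈⟨ -‿cong (trans (fromℤ-pos (n ∸ m)) (fromℕ-∸ (ℕ.<⇒≤ m<n))) ⟩
    - (fromℕ R n - fromℕ R m)  ≈⟨ ⁻¹-anti-homo-// _ _ ⟩
    fromℕ R m - fromℕ R n      ∎
  ... | no m≮n = begin
    fromℤ (m ⊖ n)          ≡⟨ ≡.cong fromℤ (ℤ.⊖-≥ (ℕ.≮⇒≥ m≮n)) ⟩
    fromℤ (+ (m ∸ n))      ≈⟨ fromℤ-pos (m ∸ n) ⟩
    fromℕ R (m ∸ n)        ≈⟨ fromℕ-∸ (ℕ.≮⇒≥ m≮n) ⟩
    fromℕ R m - fromℕ R n  ∎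

  fromℤ-+ : ∀ i j → fromℤ (i ℤ.+ j) ≈ fromℤ i + fromℤ j
  fromℤ-+ (+ m) (+ n) = begin
    fromℤ (+ (m ℕ.+ n))        ≈⟨ fromℤ-pos (m ℕ.+ n) ⟩
    fromℕ R (m ℕ.+ n)          ≈⟨ fromℕ-+ m n ⟩
    fromℕ R m + fromℕ R n      ≈⟨ +-cong (fromℤ-pos m) (fromℤ-pos n) ⟨
    fromℤ (+ m) + fromℤ (+ n)  ∎
  fromℤ-+ (+ m) -[1+ n ] = begin
    fromℤ (m ⊖ suc n)             ≈⟨ fromℤ-⊖ m (suc n) ⟩
    fromℕ R m - fromℕ R (suc n)   ≈⟨ +-cong (fromℤ-pos m) (-‿cong (fromℤ-pos (suc n))) ⟨
    fromℤ (+ m) + fromℤ -[1+ n ]  ∎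
  fromℤ-+ -[1+ m ] (+ n) = begin
    fromℤ (n ⊖ suc m)             ≈⟨ fromℤ-+ (+ n) -[1+ m ] ⟩
    fromℤ (+ n) + fromℤ -[1+ m ]  ≈⟨ +-comm _ _ ⟩
    fromℤ -[1+ m ] + fromℤ (+ n)  ∎
  fromℤ-+ -[1+ m ] -[1+ n ] = begin
    fromℤ (-[1+ m ] ℤ.+ -[1+ n ])          ≡⟨ ≡.cong (λ k → fromℤ (ℤ.- + suc k)) (ℕ.+-suc m n) ⟨
    fromℤ (ℤ.- (+ suc m ℤ.+ + suc n))      ≈⟨ fromℤ-neg (+ suc m ℤ.+ + suc n) ⟩
    - fromℤ (+ suc m ℤ.+ + suc n)          ≈⟨ -‿cong (fromℤ-+ (+ suc m) (+ suc n)) ⟩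
    - (fromℤ (+ suc m) + fromℤ (+ suc n))  ≈⟨ ⁻¹-∙-comm _ _ ⟨
    fromℤ -[1+ m ] + fromℤ -[1+ n ]        ∎

  fromℤ-*-nonneg : ∀ m j → fromℤ (+ m ℤ.* j) ≈ fromℤ (+ m) * fromℤ j
  fromℤ-*-nonneg m (+ n) = begin
    fromℤ (+ m ℤ.* + n)        ≡⟨ ≡.cong fromℤ (ℤ.pos-* m n) ⟨
    fromℤ (+ (m ℕ.* n))        ≈⟨ fromℤ-pos (m ℕ.* n) ⟩
    fromℕ R (m ℕ.* n)          ≈⟨ fromℕ-* m n ⟩
    fromℕ R m * fromℕ R n      ≈⟨ *-cong (fromℤ-pos m) (fromℤ-pos n) ⟨
    fromℤ (+ m) * fromℤ (+ n)  ∎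
  fromℤ-*-nonneg m -[1+ n ] = begin
    fromℤ (+ m ℤ.* ℤ.- + suc n)        ≡⟨ ≡.cong fromℤ (ℤ.neg-distribʳ-* (+ m) (+ suc n)) ⟨
    fromℤ (ℤ.- (+ m ℤ.* + suc n))      ≈⟨ fromℤ-neg (+ m ℤ.* + suc n) ⟩
    - fromℤ (+ m ℤ.* + suc n)          ≈⟨ -‿cong (fromℤ-*-nonneg m (+ suc n)) ⟩
    - (fromℤ (+ m) * fromℤ (+ suc n))  ≈⟨ -‿distribʳ-* _ _ ⟩
    fromℤ (+ m) * fromℤ -[1+ n ]       ∎

  fromℤ-* : ∀ i j → fromℤ (i ℤ.* j) ≈ fromℤ i * fromℤ j
  fromℤ-* (+ m)    j = fromℤ-*-nonneg m j
  fromℤ-* -[1+ m ] j = begin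
    fromℤ (ℤ.- + suc m ℤ.* j)      ≡⟨ ≡.cong fromℤ (ℤ.neg-distribˡ-* (+ suc m) j) ⟨
    fromℤ (ℤ.- (+ suc m ℤ.* j))    ≈⟨ fromℤ-neg (+ suc m ℤ.* j) ⟩
    - fromℤ (+ suc m ℤ.* j)        ≈⟨ -‿cong (fromℤ-*-nonneg (suc m) j) ⟩
    - (fromℤ (+ suc m) * fromℤ j)  ≈⟨ -‿distribˡ-* _ _ ⟩
    fromℤ -[1+ m ] * fromℤ j       ∎

  fromℤ-morphism : ℤ.+-*-rawRing -Raw-AlmostCommutative⟶ fromCommutativeRing R
  fromℤ-morphism = record
    { ⟦_⟧ = fromℤ ; +-homo = fromℤ-+ ; *-homo = fromℤ-* ; -‿homo = fromℤ-neg
    ; 0-homo = refl ; 1-homo = refl }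

  fromℤ-≟ : ∀ i j → Maybe (fromℤ i ≈ fromℤ j)
  fromℤ-≟ i j with i ℤ.≟ j
  ... | yes ≡.refl = just refl
  ... | no _       = nothing

  open import Algebra.Solver.Ring ℤ.+-*-rawRing (fromCommutativeRing R) fromℤ-morphism fromℤ-≟ public

module DegenerateStirling {c ℓ : Level} (R : CommutativeRing c ℓ) where
  open CommutativeRing R
  open FromℕProperties R
  open ℤ-Solver R
  open import Algebra.Definitions _≈_ using (Congruent₁)
  open import Algebra.Properties.Ring ring using (-‿distribˡ-*; x[y-z]≈xy-xz)
  open import Algebra.Properties.AbelianGroup +-abelianGroup
    using (⁻¹-∙-comm; x≈y⇒x∙y⁻¹≈ε; x∙y⁻¹≈ε⇒x≈y)
  open import Relation.Binary.Reasoning.Setoid setoid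

  sign-+ : ∀ m n → sign R (m ℕ.+ n) ≈ sign R m * sign R n
  sign-+ zero    n = sym (*-identityˡ _)
  sign-+ (suc m) n = trans (-‿cong (sign-+ m n)) (-‿distribˡ-* _ _)

  sign-*-sign : ∀ n → sign R n * sign R n ≈ 1#
  sign-*-sign zero    = *-identityˡ 1#
  sign-*-sign (suc n) = trans (neg-*-neg (sign R n)) (sign-*-sign n)
    where
    neg-*-neg : ∀ s → - s * - s ≈ s * s
    neg-*-neg = solve 1 (λ s → :- s :* :- s := s :* s) refl

  sign-∸ : ∀ {m n} → m ≤ n → sign R m ≈ sign R n * sign R (n ∸ m)
  sign-∸ {m} {n} m≤n = begin
    sign R m                               ≈⟨ *-identityʳ _ ⟨
    sign R m * 1#                          ≈⟨ *-congˡ (sign-*-sign (n ∸ m)) ⟨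
    sign R m * (sign R d * sign R d)       ≈⟨ *-assoc _ _ _ ⟨
    sign R m * sign R d * sign R d         ≈⟨ *-congʳ (sign-+ m d) ⟨
    sign R (m ℕ.+ d) * sign R d            ≡⟨ ≡.cong (λ k → sign R k * sign R d) (ℕ.m+[n∸m]≡n m≤n) ⟩
    sign R n * sign R d                    ∎
    where d = n ∸ m

  sumTo-cong-≤ : ∀ n {f g : ℕ → Carrier} → (∀ i → i ≤ n → f i ≈ g i) →
                 sumTo R n f ≈ sumTo R n g
  sumTo-cong-≤ zero    f≈g = f≈g 0 ℕ.z≤n
  sumTo-cong-≤ (suc n) f≈g =
    +-cong (sumTo-cong-≤ n (λ i i≤n → f≈g i (ℕ.m≤n⇒m≤1+n i≤n))) (f≈g (suc n) ℕ.≤-refl)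

  sumTo-cong : ∀ n {f g : ℕ → Carrier} → (∀ i → f i ≈ g i) → sumTo R n f ≈ sumTo R n g
  sumTo-cong n f≈g = sumTo-cong-≤ n (λ i _ → f≈g i)

  sumTo-+ : ∀ n (f g : ℕ → Carrier) →
            sumTo R n (λ i → f i + g i) ≈ sumTo R n f + sumTo R n g
  sumTo-+ zero    f g = refl
  sumTo-+ (suc n) f g = trans (+-congʳ (sumTo-+ n f g)) (interchange _ _ _ _)
    where
    interchange : ∀ a b c d → (a + b) + (c + d) ≈ (a + c) + (b + d)
    interchange = solve 4 (λ a b c d → (a :+ b) :+ (c :+ d) := (a :+ c) :+ (b :+ d)) refl

  *-distribˡ-sumTo : ∀ n a (f : ℕ → Carrier) → a * sumTo R n f ≈ sumTo R n (λ i → a * f i)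
  *-distribˡ-sumTo zero    a f = refl
  *-distribˡ-sumTo (suc n) a f = trans (distribˡ _ _ _) (+-congʳ (*-distribˡ-sumTo n a f))

  *-distribʳ-sumTo : ∀ n a (f : ℕ → Carrier) → sumTo R n f * a ≈ sumTo R n (λ i → f i * a)
  *-distribʳ-sumTo zero    a f = refl
  *-distribʳ-sumTo (suc n) a f = trans (distribʳ _ _ _) (+-congʳ (*-distribʳ-sumTo n a f))

  *-distrib-sumTo : ∀ n a b (f : ℕ → Carrier) →
                    a * sumTo R n f * b ≈ sumTo R n (λ i → a * f i * b)
  *-distrib-sumTo n a b f =
    trans (*-congʳ (*-distribˡ-sumTo n a f)) (*-distribʳ-sumTo n b (λ i → a * f i))

  -‿distrib-sumTo : ∀ n (f : ℕ → Carrier) → - sumTo R n f ≈ sumTo R n (λ i → - f i)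
  -‿distrib-sumTo zero    f = refl
  -‿distrib-sumTo (suc n) f = trans (sym (⁻¹-∙-comm _ _)) (+-congʳ (-‿distrib-sumTo n f))

  sumTo-comm : ∀ m n (f : ℕ → ℕ → Carrier) →
               sumTo R m (λ i → sumTo R n (f i)) ≈ sumTo R n (λ k → sumTo R m (λ i → f i k))
  sumTo-comm zero    n f = refl
  sumTo-comm (suc m) n f = trans (+-congʳ (sumTo-comm m n f)) (sym (sumTo-+ n _ (f (suc m))))

  sumTo-suc : ∀ n (f : ℕ → Carrier) → sumTo R (suc n) f ≈ f 0 + sumTo R n (λ i → f (suc i))
  sumTo-suc zero    f = refl
  sumTo-suc (suc n) f = trans (+-congʳ (sumTo-suc n f)) (+-assoc _ _ _)

  sumTo-reverse : ∀ n (f : ℕ → Carrier) → sumTo R n f ≈ sumTo R n (λ i → f (n ∸ i))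
  sumTo-reverse zero    f = refl
  sumTo-reverse (suc n) f = begin
    sumTo R (suc n) f                        ≈⟨ sumTo-suc n f ⟩
    f 0 + sumTo R n (λ i → f (suc i))        ≈⟨ +-congˡ (sumTo-reverse n (λ i → f (suc i))) ⟩
    f 0 + sumTo R n (λ i → f (suc (n ∸ i)))  ≈⟨ +-comm _ _ ⟩
    sumTo R n (λ i → f (suc (n ∸ i))) + f 0  ≈⟨ +-cong (sumTo-cong-≤ n suc-∸) n∸n ⟨
    sumTo R (suc n) (λ i → f (suc n ∸ i))    ∎
    where
    n∸n : f (n ∸ n) ≈ f 0
    n∸n = reflexive (≡.cong f (ℕ.n∸n≡0 n))
    suc-∸ : ∀ i → i ≤ n → f (suc n ∸ i) ≈ f (suc (n ∸ i))
    suc-∸ i i≤n = reflexive (≡.cong f (ℕ.+-∸-assoc 1 i≤n))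

  sumTo-zero : ∀ n {f : ℕ → Carrier} → (∀ i → i ≤ n → f i ≈ 0#) → sumTo R n f ≈ 0#
  sumTo-zero zero    f≈0 = f≈0 0 ℕ.z≤n
  sumTo-zero (suc n) f≈0 =
    trans (+-cong (sumTo-zero n (λ i i≤n → f≈0 i (ℕ.m≤n⇒m≤1+n i≤n))) (f≈0 (suc n) ℕ.≤-refl))
          (+-identityʳ 0#)

  sumTo-single : ∀ n {j} {f : ℕ → Carrier} → j ≤ n → (∀ i → i ≡.≢ j → f i ≈ 0#) →
                 sumTo R n f ≈ f j
  sumTo-single zero    ℕ.z≤n _ = refl
  sumTo-single (suc n) j≤1+n f≈0 with ℕ.m≤n⇒m<n∨m≡n j≤1+n
  ... | inj₁ (ℕ.s≤s j≤n) =
    trans (+-cong (sumTo-single n j≤n f≈0) (f≈0 (suc n) (λ 1+n≡j → ℕ.<-irrefl (≡.sym 1+n≡j) (ℕ.s≤s j≤n))))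
          (+-identityʳ _)
  ... | inj₂ ≡.refl =
    trans (+-congʳ (sumTo-zero n (λ i i≤n → f≈0 i (λ i≡1+n → ℕ.<-irrefl i≡1+n (ℕ.s≤s i≤n)))))
          (+-identityˡ _)

  binomialConv : ℕ → (ℕ → Carrier) → (ℕ → Carrier) → Carrier
  binomialConv n f g = sumTo R n (λ α → fromℕ R (n C α) * f α * g (n ∸ α))

  binomialConv-suc : ∀ n (f g : ℕ → Carrier) →
    binomialConv (suc n) f g ≈ binomialConv n (λ α → f (suc α)) g + binomialConv n f (λ m → g (suc m))
  binomialConv-suc n f g = begin
    binomialConv (suc n) f g
      ≈⟨ sumTo-suc n _ ⟩
    first + sumTo R n (λ α → fromℕ R (suc n C suc α) * f (suc α) * g (n ∸ α))
      ≈⟨ +-congˡ (sumTo-cong n (λ α → pascal (n C α) (n C suc α) (nCk+nC[k+1]≡[n+1]C[k+1] n α))) ⟩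
    first + sumTo R n (λ α → fromℕ R (n C α) * f (suc α) * g (n ∸ α) + rest α)
      ≈⟨ +-congˡ (sumTo-+ n _ rest) ⟩
    first + (binomialConv n (λ α → f (suc α)) g + sumTo R n rest)
      ≈⟨ x+[y+z]≈y+[x+z] _ _ _ ⟩
    binomialConv n (λ α → f (suc α)) g + (first + sumTo R n rest)
      ≈⟨ +-congˡ (sumTo-suc n h) ⟨
    binomialConv n (λ α → f (suc α)) g + (sumTo R n h + h (suc n))
      ≈⟨ +-congˡ (+-cong (sumTo-cong-≤ n suc-∸) h[1+n]≈0) ⟩
    binomialConv n (λ α → f (suc α)) g + (binomialConv n f (λ m → g (suc m)) + 0#)
      ≈⟨ +-congˡ (+-identityʳ _) ⟩
    binomialConv n (λ α → f (suc α)) g + binomialConv n f (λ m → g (suc m)) ∎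
    where
    first = fromℕ R (suc n C 0) * f 0 * g (suc n)
    rest : ℕ → Carrier
    rest α = fromℕ R (n C suc α) * f (suc α) * g (n ∸ α)
    h : ℕ → Carrier
    h α = fromℕ R (n C α) * f α * g (suc n ∸ α)
    suc-∸ : ∀ α → α ≤ n → h α ≈ fromℕ R (n C α) * f α * g (suc (n ∸ α))
    suc-∸ α α≤n = *-congˡ (reflexive (≡.cong g (ℕ.+-∸-assoc 1 α≤n)))
    h[1+n]≈0 : h (suc n) ≈ 0#
    h[1+n]≈0 = begin
      fromℕ R (n C suc n) * f (suc n) * g (n ∸ n)
        ≡⟨ ≡.cong (λ k → fromℕ R k * f (suc n) * g (n ∸ n)) (k>n⇒nCk≡0 (ℕ.n<1+n n)) ⟩
      0# * f (suc n) * g (n ∸ n)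
        ≈⟨ trans (*-congʳ (zeroˡ _)) (zeroˡ _) ⟩
      0# ∎
    pascal : ∀ a b {c x y} → a ℕ.+ b ≡.≡ c → fromℕ R c * x * y ≈ fromℕ R a * x * y + fromℕ R b * x * y
    pascal a b ≡.refl = trans (*-congʳ (*-congʳ (fromℕ-+ a b))) (distrib₃ _ _ _ _)
      where
      distrib₃ : ∀ p q u v → (p + q) * u * v ≈ p * u * v + q * u * v
      distrib₃ = solve 4 (λ p q u v → (p :+ q) :* u :* v := p :* u :* v :+ q :* u :* v) refl
    x+[y+z]≈y+[x+z] : ∀ x y z → x + (y + z) ≈ y + (x + z)
    x+[y+z]≈y+[x+z] = solve 3 (λ x y z → x :+ (y :+ z) := y :+ (x :+ z)) refl

  degFall-cong : ∀ {x y} n μ → x ≈ y → degFall R x n μ ≈ degFall R y n μ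
  degFall-cong zero    μ x≈y = refl
  degFall-cong (suc n) μ x≈y = *-cong (degFall-cong n μ x≈y) (+-congʳ x≈y)

  degFall-+ : ∀ a b n μ →
    degFall R (a + b) n μ ≈ binomialConv n (λ α → degFall R a α μ) (λ m → degFall R b m μ)
  degFall-+ a b zero    μ = sym (trans (*-identityʳ _) (trans (*-identityʳ _) (+-identityʳ 1#)))
  degFall-+ a b (suc n) μ = begin
    degFall R (a + b) n μ * (a + b - fromℕ R n * μ)
      ≈⟨ *-congʳ (degFall-+ a b n μ) ⟩
    binomialConv n A B * (a + b - fromℕ R n * μ)
      ≈⟨ *-distribʳ-sumTo n _ _ ⟩
    sumTo R n (λ α → fromℕ R (n C α) * A α * B (n ∸ α) * (a + b - fromℕ R n * μ))
      ≈⟨ sumTo-cong-≤ n (λ α α≤n → trans (*-congˡ (+-congˡ (-‿cong (*-congʳ (split α≤n)))))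
                                         (split-last-factor _ _ _ a b _ _ μ)) ⟩
    sumTo R n (λ α → fromℕ R (n C α) * A (suc α) * B (n ∸ α) + fromℕ R (n C α) * A α * B (suc (n ∸ α)))
      ≈⟨ sumTo-+ n _ _ ⟩
    binomialConv n (λ α → A (suc α)) B + binomialConv n A (λ m → B (suc m))
      ≈⟨ binomialConv-suc n A B ⟨
    binomialConv (suc n) A B ∎
    where
    A B : ℕ → Carrier
    A α = degFall R a α μ
    B m = degFall R b m μ
    split : ∀ {α} → α ≤ n → fromℕ R n ≈ fromℕ R α + fromℕ R (n ∸ α)
    split {α} α≤n = trans (reflexive (≡.cong (fromℕ R) (≡.sym (ℕ.m+[n∸m]≡n α≤n)))) (fromℕ-+ α (n ∸ α))
    -- a + b - (p + q) μ = (a - p μ) + (b - q μ)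
    split-last-factor : ∀ c u v a b p q μ →
      c * u * v * ((a + b) - (p + q) * μ) ≈ c * (u * (a - p * μ)) * v + c * u * (v * (b - q * μ))
    split-last-factor = solve 8 (λ c u v a b p q μ →
      c :* u :* v :* ((a :+ b) :- (p :+ q) :* μ) := c :* (u :* (a :- p :* μ)) :* v :+ c :* u :* (v :* (b :- q :* μ)))
      refl

  degFall-neg : ∀ x n μ → degFall R (- x) n μ ≈ sign R n * degFall R x n (- μ)
  degFall-neg x zero    μ = sym (*-identityˡ 1#)
  degFall-neg x (suc n) μ = trans (*-congʳ (degFall-neg x n μ)) (pull-sign (sign R n) _ x (fromℕ R n) μ)
    where
    pull-sign : ∀ s d x p μ → s * d * (- x - p * μ) ≈ - s * (d * (x - p * - μ))
    pull-sign = solve 5 (λ s d x p μ → s :* d :* (:- x :- p :* μ) := :- s :* (d :* (x :- p :* :- μ))) refl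

  degFall-sub : ∀ x y n μ → degFall R (y - x) n μ ≈
    sumTo R n (λ α → fromℕ R (n C α) * sign R α * degFall R x α (- μ) * degFall R y (n ∸ α) μ)
  degFall-sub x y n μ = begin
    degFall R (y - x) n μ
      ≈⟨ degFall-cong n μ (+-comm y (- x)) ⟩
    degFall R (- x + y) n μ
      ≈⟨ degFall-+ (- x) y n μ ⟩
    binomialConv n (λ α → degFall R (- x) α μ) (λ m → degFall R y m μ)
      ≈⟨ sumTo-cong n (λ α → *-congʳ (trans (*-congˡ (degFall-neg x α μ)) (sym (*-assoc _ _ _)))) ⟩
    sumTo R n (λ α → fromℕ R (n C α) * sign R α * degFall R x α (- μ) * degFall R y (n ∸ α) μ) ∎

  fall-+1#-suc : ∀ x m → fall R (x + 1#) (suc m) ≈ (x + 1#) * fall R x m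
  fall-+1#-suc x zero    = shift-0 (x + 1#)
    where
    shift-0 : ∀ y → 1# * (y - 0# * 1#) ≈ y * 1#
    shift-0 = solve 1 (λ y → con (+ 1) :* (y :- con (+ 0) :* con (+ 1)) := y :* con (+ 1)) refl
  fall-+1#-suc x (suc m) = trans (*-congʳ (fall-+1#-suc x m)) (shift x (fall R x m) (fromℕ R m))
    where
    shift : ∀ x d p → (x + 1#) * d * ((x + 1#) - (1# + p) * 1#) ≈ (x + 1#) * (d * (x - p * 1#))
    shift = solve 3 (λ x d p → (x :+ con (+ 1)) :* d :* ((x :+ con (+ 1)) :- (con (+ 1) :+ p) :* con (+ 1))
                               := (x :+ con (+ 1)) :* (d :* (x :- p :* con (+ 1)))) refl

  fall-forward-difference : ∀ x m → fall R (x + 1#) m - fall R x m ≈ fromℕ R m * fall R x (ℕ.pred m)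
  fall-forward-difference x zero    = trans (-‿inverseʳ 1#) (sym (zeroˡ 1#))
  fall-forward-difference x (suc m) =
    trans (+-congʳ (fall-+1#-suc x m)) (difference x (fall R x m) (fromℕ R m))
    where
    difference : ∀ x d p → (x + 1#) * d - d * (x - p * 1#) ≈ (1# + p) * d
    difference = solve 3 (λ x d p →
      (x :+ con (+ 1)) :* d :- d :* (x :- p :* con (+ 1)) := (con (+ 1) :+ p) :* d) refl

  fall-fromℕ-< : ∀ {k m} → k ℕ.< m → fall R (fromℕ R k) m ≈ 0#
  fall-fromℕ-< {k} {suc m} (ℕ.s≤s k≤m) with ℕ.m≤n⇒m<n∨m≡n k≤m
  ... | inj₁ k<m    = trans (*-congʳ (fall-fromℕ-< k<m)) (zeroˡ _)
  ... | inj₂ ≡.refl = trans (*-congˡ (trans (+-congˡ (-‿cong (*-identityʳ _))) (-‿inverseʳ _))) (zeroʳ _)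

  -- k ∸ j truncates to 0 for k < j, but then both sides vanish.
  fall-fromℕ-suc : ∀ k j → fall R (fromℕ R k) (suc j) ≈ fall R (fromℕ R k) j * fromℕ R (k ∸ j)
  fall-fromℕ-suc k j with j ℕ.≤? k
  ... | yes j≤k = *-congˡ (trans (+-congˡ (-‿cong (*-identityʳ _))) (sym (fromℕ-∸ j≤k)))
  ... | no  j≰k = trans (fall-fromℕ-< (ℕ.m≤n⇒m≤1+n k<j)) (sym (trans (*-congʳ (fall-fromℕ-< k<j)) (zeroˡ _)))
    where k<j = ℕ.≰⇒> j≰k

  Δ : ℕ → (Carrier → Carrier) → Carrier → Carrier
  Δ j f x = binomialConv j (λ i → f (x + fromℕ R i)) (sign R)

  Δ-cong : ∀ j {f g : Carrier → Carrier} x → (∀ y → f y ≈ g y) → Δ j f x ≈ Δ j g x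
  Δ-cong j x f≈g = sumTo-cong j (λ i → *-congʳ (*-congˡ (f≈g _)))

  Δ-suc : ∀ j {f} → Congruent₁ f → ∀ x → Δ (suc j) f x ≈ Δ j f (x + 1#) - Δ j f x
  Δ-suc j {f} f-cong x = begin
    Δ (suc j) f x
      ≈⟨ binomialConv-suc j F (sign R) ⟩
    binomialConv j (λ i → F (suc i)) (sign R) + binomialConv j F (λ m → - sign R m)
      ≈⟨ +-cong (sumTo-cong j (λ i → *-congʳ (*-congˡ (f-cong (sym (+-assoc x 1# _))))))
                (sumTo-cong j (λ i → pull-neg _ _ _)) ⟩
    Δ j f (x + 1#) + sumTo R j (λ i → - (fromℕ R (j C i) * F i * sign R (j ∸ i)))
      ≈⟨ +-congˡ (-‿distrib-sumTo j _) ⟨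
    Δ j f (x + 1#) - Δ j f x ∎
    where
    F : ℕ → Carrier
    F i = f (x + fromℕ R i)
    pull-neg : ∀ a b c → a * b * - c ≈ - (a * b * c)
    pull-neg = solve 3 (λ a b c → a :* b :* :- c := :- (a :* b :* c)) refl

  Δ-fall : ∀ j x k → Δ j (λ y → fall R y k) x ≈ fall R (fromℕ R k) j * fall R x (k ∸ j)
  Δ-fall zero    x k =
    trans (*-identityʳ _) (trans (*-congʳ (+-identityʳ 1#)) (*-congˡ (degFall-cong k 1# (+-identityʳ x))))
  Δ-fall (suc j) x k = begin
    Δ (suc j) (λ y → fall R y k) x
      ≈⟨ Δ-suc j (degFall-cong k 1#) x ⟩
    Δ j (λ y → fall R y k) (x + 1#) - Δ j (λ y → fall R y k) x
      ≈⟨ +-cong (Δ-fall j (x + 1#) k) (-‿cong (Δ-fall j x k)) ⟩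
    K * fall R (x + 1#) (k ∸ j) - K * fall R x (k ∸ j)
      ≈⟨ x[y-z]≈xy-xz K _ _ ⟨
    K * (fall R (x + 1#) (k ∸ j) - fall R x (k ∸ j))
      ≈⟨ *-congˡ (fall-forward-difference x (k ∸ j)) ⟩
    K * (fromℕ R (k ∸ j) * fall R x (ℕ.pred (k ∸ j)))
      ≈⟨ *-assoc _ _ _ ⟨
    K * fromℕ R (k ∸ j) * fall R x (ℕ.pred (k ∸ j))
      ≈⟨ *-cong (fall-fromℕ-suc k j) (reflexive (≡.cong (fall R x) (≡.sym (ℕ.pred[m∸n]≡m∸[1+n] k j)))) ⟨
    fall R (fromℕ R k) (suc j) * fall R x (k ∸ suc j) ∎
    where K = fall R (fromℕ R k) j

  Δ-linear : ∀ j m (c : ℕ → Carrier) (g : ℕ → Carrier → Carrier) x →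
             Δ j (λ y → sumTo R m (λ k → c k * g k y)) x ≈ sumTo R m (λ k → c k * Δ j (g k) x)
  Δ-linear j m c g x = begin
    Δ j (λ y → sumTo R m (λ k → c k * g k y)) x
      ≈⟨ sumTo-cong j (λ i → trans (*-distrib-sumTo m _ _ _) (sumTo-cong m (λ k → rearrange _ _ _ _))) ⟩
    sumTo R j (λ i → sumTo R m (λ k → c k * term k i))
      ≈⟨ sumTo-comm j m _ ⟩
    sumTo R m (λ k → sumTo R j (λ i → c k * term k i))
      ≈⟨ sumTo-cong m (λ k → *-distribˡ-sumTo j (c k) _) ⟨
    sumTo R m (λ k → c k * Δ j (g k) x) ∎
    where
    term : ℕ → ℕ → Carrier
    term k i = fromℕ R (j C i) * g k (x + fromℕ R i) * sign R (j ∸ i)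
    rearrange : ∀ b c u s → b * (c * u) * s ≈ c * (b * u * s)
    rearrange = solve 4 (λ b c u s → b :* (c :* u) :* s := c :* (b :* u :* s)) refl

  Δ-fall-0# : ∀ j k → k ≡.≢ j → Δ j (λ y → fall R y k) 0# ≈ 0#
  Δ-fall-0# j k k≢j with ℕ.<-cmp k j
  ... | tri< k<j _ _ = trans (Δ-fall j 0# k) (trans (*-congʳ (fall-fromℕ-< k<j)) (zeroˡ _))
  ... | tri≈ _ k≡j _ = contradiction k≡j k≢j
  ... | tri> _ _ j<k = trans (Δ-fall j 0# k) (trans (*-congˡ (fall-fromℕ-< (ℕ.m<n⇒0<n∸m j<k))) (zeroʳ _))

  Δ-fall-0#-diagonal : ∀ j → Δ j (λ y → fall R y j) 0# ≈ fall R (fromℕ R j) j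
  Δ-fall-0#-diagonal j =
    trans (Δ-fall j 0# j) (trans (*-congˡ (reflexive (≡.cong (fall R 0#) (ℕ.n∸n≡0 j)))) (*-identityʳ _))

  Δ-degStirling : ∀ {μ S} → IsDegStirling2 R μ S → ∀ j α →
                  Δ j (λ y → degFall R y α μ) 0# ≈ fall R (fromℕ R j) j * S α j
  Δ-degStirling {μ} {S} (expansion , vanishing) j α = begin
    Δ j (λ y → degFall R y α μ) 0#
      ≈⟨ Δ-cong j 0# (expansion α) ⟩
    Δ j (λ y → sumTo R α (λ k → S α k * fall R y k)) 0#
      ≈⟨ Δ-linear j α (S α) (λ k y → fall R y k) 0# ⟩
    sumTo R α (λ k → S α k * Δ j (λ y → fall R y k) 0#)
      ≈⟨ collapse ⟩
    S α j * fall R (fromℕ R j) j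
      ≈⟨ *-comm _ _ ⟩
    fall R (fromℕ R j) j * S α j ∎
    where
    off-diagonal : ∀ k → k ≡.≢ j → S α k * Δ j (λ y → fall R y k) 0# ≈ 0#
    off-diagonal k k≢j = trans (*-congˡ (Δ-fall-0# j k k≢j)) (zeroʳ _)
    collapse : sumTo R α (λ k → S α k * Δ j (λ y → fall R y k) 0#) ≈ S α j * fall R (fromℕ R j) j
    collapse with j ℕ.≤? α
    ... | yes j≤α = trans (sumTo-single α j≤α off-diagonal) (*-congˡ (Δ-fall-0#-diagonal j))
    ... | no  j≰α =
      trans (sumTo-zero α (λ k k≤α → off-diagonal k (λ k≡j → j≰α (≡.subst (ℕ._≤ α) k≡j k≤α))))
            (sym (trans (*-congʳ (vanishing α j (ℕ.≰⇒> j≰α))) (zeroˡ _)))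

  Δ-0#-reverse : ∀ j {f} → Congruent₁ f →
                 Δ j f 0# ≈ sumTo R j (λ i → fromℕ R (j C i) * f (fromℕ R j - fromℕ R i) * sign R i)
  Δ-0#-reverse j {f} f-cong = trans (sumTo-reverse j _) (sumTo-cong-≤ j reflect)
    where
    reflect : ∀ i → i ≤ j →
      fromℕ R (j C (j ∸ i)) * f (0# + fromℕ R (j ∸ i)) * sign R (j ∸ (j ∸ i)) ≈
      fromℕ R (j C i) * f (fromℕ R j - fromℕ R i) * sign R i
    reflect i i≤j = *-cong (*-cong (reflexive (≡.cong (fromℕ R) (≡.sym (nCk≡nC[n∸k] i≤j))))
                                   (f-cong (trans (+-identityˡ _) (fromℕ-∸ i≤j))))
                           (reflexive (≡.cong (sign R) (ℕ.m∸[m∸n]≡n i≤j)))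

  Δ-0#-alternating : ∀ j {f} → Congruent₁ f →
    sumTo R j (λ i → fromℕ R (j C i) * f (fromℕ R i) * sign R i) ≈ sign R j * Δ j f 0#
  Δ-0#-alternating j {f} f-cong = begin
    sumTo R j (λ i → fromℕ R (j C i) * f (fromℕ R i) * sign R i)
      ≈⟨ sumTo-cong-≤ j (λ i i≤j → *-cong (*-congˡ (f-cong (sym (+-identityˡ _)))) (sign-∸ i≤j)) ⟩
    sumTo R j (λ i → fromℕ R (j C i) * f (0# + fromℕ R i) * (sign R j * sign R (j ∸ i)))
      ≈⟨ sumTo-cong j (λ i → rearrange _ _ _ _) ⟩
    sumTo R j (λ i → sign R j * (fromℕ R (j C i) * f (0# + fromℕ R i) * sign R (j ∸ i)))
      ≈⟨ *-distribˡ-sumTo j (sign R j) _ ⟨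
    sign R j * Δ j f 0# ∎
    where
    rearrange : ∀ b u s t → b * u * (s * t) ≈ s * (b * u * t)
    rearrange = solve 4 (λ b u s t → b :* u :* (s :* t) := s :* (b :* u :* t)) refl

  fall-fromℕ-nonzero : NoZeroDivisors R → CharZero R →
                       ∀ {i j} → i ≤ j → ¬ fall R (fromℕ R j) i ≈ 0#
  fall-fromℕ-nonzero nzd cz {zero}          _           1≈0 = cz 0 (trans (+-identityʳ 1#) 1≈0)
  fall-fromℕ-nonzero nzd cz {suc i} {suc j} (ℕ.s≤s i≤j) prod≈0 with nzd _ _ prod≈0
  ... | inj₁ fall≈0   = fall-fromℕ-nonzero nzd cz (ℕ.m≤n⇒m≤1+n i≤j) fall≈0
  ... | inj₂ factor≈0 = cz (j ∸ i) (begin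
    fromℕ R (suc (j ∸ i))             ≡⟨ ≡.cong (fromℕ R) (ℕ.+-∸-assoc 1 i≤j) ⟨
    fromℕ R (suc j ∸ i)               ≈⟨ fromℕ-∸ (ℕ.m≤n⇒m≤1+n i≤j) ⟩
    fromℕ R (suc j) - fromℕ R i       ≈⟨ +-congˡ (-‿cong (*-identityʳ _)) ⟨
    fromℕ R (suc j) - fromℕ R i * 1#  ≈⟨ factor≈0 ⟩
    0#                                ∎)

  *-cancelˡ-nonzero : NoZeroDivisors R → ∀ {a x y} → ¬ a ≈ 0# → a * x ≈ a * y → x ≈ y
  *-cancelˡ-nonzero nzd {a} {x} {y} a≉0 ax≈ay
    with nzd a (x - y) (trans (x[y-z]≈xy-xz a x y) (x≈y⇒x∙y⁻¹≈ε ax≈ay))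
  ... | inj₁ a≈0   = contradiction a≈0 a≉0
  ... | inj₂ x-y≈0 = x∙y⁻¹≈ε⇒x≈y x y x-y≈0

  fall-*-reciprocity : ∀ {λ′ S⁺ S⁻} → IsDegStirling2 R λ′ S⁺ → IsDegStirling2 R (- λ′) S⁻ → ∀ n j →
    fall R (fromℕ R j) j * S⁺ n j ≈
    fall R (fromℕ R j) j *
      sumTo R n (λ α → fromℕ R (n C α) * sign R (α ℕ.+ j) * S⁻ α j * degFall R (fromℕ R j) (n ∸ α) λ′)
  fall-*-reciprocity {λ′} {S⁺} {S⁻} S⁺-stirling S⁻-stirling n j = begin
    J * S⁺ n j
      ≈⟨ Δ-degStirling S⁺-stirling j n ⟨
    Δ j (λ y → degFall R y n λ′) 0#
      ≈⟨ Δ-0#-reverse j (degFall-cong n λ′) ⟩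
    sumTo R j (λ i → fromℕ R (j C i) * degFall R (fromℕ R j - fromℕ R i) n λ′ * sign R i)
      ≈⟨ sumTo-cong j (λ i → *-congʳ (*-congˡ (degFall-sub (fromℕ R i) (fromℕ R j) n λ′))) ⟩
    sumTo R j (λ i → fromℕ R (j C i) * sumTo R n (λ α → W′ α * D⁻ i α * D⁺ α) * sign R i)
      ≈⟨ sumTo-cong j (λ i → trans (*-distrib-sumTo n _ _ _) (sumTo-cong n (λ α → rearrange _ _ _ _ _))) ⟩
    sumTo R j (λ i → sumTo R n (λ α → W α * (fromℕ R (j C i) * D⁻ i α * sign R i)))
      ≈⟨ sumTo-comm j n _ ⟩
    sumTo R n (λ α → sumTo R j (λ i → W α * (fromℕ R (j C i) * D⁻ i α * sign R i)))
      ≈⟨ sumTo-cong n (λ α → trans (sym (*-distribˡ-sumTo j (W α) _)) (*-congˡ (inner α))) ⟩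
    sumTo R n (λ α → W α * (sign R j * (J * S⁻ α j)))
      ≈⟨ sumTo-cong n (λ α → trans (*-congˡ (*-congʳ (*-congʳ (*-congˡ (sign-+ α j))))) (regroup _ _ _ _ _ _)) ⟨
    sumTo R n (λ α → J * (fromℕ R (n C α) * sign R (α ℕ.+ j) * S⁻ α j * D⁺ α))
      ≈⟨ *-distribˡ-sumTo n J _ ⟨
    J * sumTo R n (λ α → fromℕ R (n C α) * sign R (α ℕ.+ j) * S⁻ α j * D⁺ α) ∎
    where
    J = fall R (fromℕ R j) j
    D⁺ : ℕ → Carrier
    D⁺ α = degFall R (fromℕ R j) (n ∸ α) λ′
    D⁻ : ℕ → ℕ → Carrier
    D⁻ i α = degFall R (fromℕ R i) α (- λ′)
    W′ W : ℕ → Carrier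
    W′ α = fromℕ R (n C α) * sign R α
    W  α = W′ α * D⁺ α
    inner : ∀ α → sumTo R j (λ i → fromℕ R (j C i) * D⁻ i α * sign R i) ≈ sign R j * (J * S⁻ α j)
    inner α = trans (Δ-0#-alternating j (degFall-cong α (- λ′))) (*-congˡ (Δ-degStirling S⁻-stirling j α))
    rearrange : ∀ b w d⁻ d⁺ t → b * (w * d⁻ * d⁺) * t ≈ w * d⁺ * (b * d⁻ * t)
    rearrange = solve 5 (λ b w d⁻ d⁺ t → b :* (w :* d⁻ :* d⁺) :* t := w :* d⁺ :* (b :* d⁻ :* t)) refl
    regroup : ∀ J c s t S d → J * (c * (s * t) * S * d) ≈ c * s * d * (t * (J * S))
    regroup = solve 6 (λ J c s t S d → J :* (c :* (s :* t) :* S :* d) := c :* s :* d :* (t :* (J :* S))) refl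

open import Data.Nat using (_+_)

theorem2p6 : {c ℓ : Level} (R : CommutativeRing c ℓ) →
    NoZeroDivisors R → CharZero R →
    (λ′ : CommutativeRing.Carrier R) → ¬ (CommutativeRing._≈_ R λ′ (CommutativeRing.0# R)) →
    (S⁺ S⁻ : ℕ → ℕ → CommutativeRing.Carrier R) →
    IsDegStirling2 R λ′ S⁺ → IsDegStirling2 R (CommutativeRing.-_ R λ′) S⁻ →
    (n j : ℕ) → j ≤ n →
    CommutativeRing._≈_ R (S⁺ n j)
      (sumTo R n (λ α → CommutativeRing._*_ R
        (CommutativeRing._*_ R (CommutativeRing._*_ R (fromℕ R (n C α)) (sign R (α + j))) (S⁻ α j))
        (degFall R (fromℕ R j) (n ∸ α) λ′)))
theorem2p6 R noZeroDivisors charZero λ′ _ S⁺ S⁻ S⁺-stirling S⁻-stirling n j _ =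
  *-cancelˡ-nonzero noZeroDivisors
    (fall-fromℕ-nonzero noZeroDivisors charZero (ℕ.≤-refl {j}))
    (fall-*-reciprocity {λ′} {S⁺} {S⁻} S⁺-stirling S⁻-stirling n j)
  where open DegenerateStirling R
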